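{- For every $n\ge0$, $$g_n(\lambda)=\pm\prod_{j=1}^{n}\Big(\lambda-\big(e\big(\tfrac{j}{2n+2}\big)+e\big(-\tfrac{j}{2n+2}\big)\big)\Big)$$ for a suitable sign $\pm$ (depending on $n$).
   Context: $e(x)=e^{2\pi i x}$. Let $\mathcal{I}$ be the set of finite subsets $I\subset\mathbf{N}_0$ such that $i\equiv|[0,i)\cap I|\pmod 2$ for every $i\in I$, and for $n\ge0$ let $$f_n(\lambda,m_0,\dots,m_{n-1})=\sum_{\substack{0\le k\le n\\ k\equiv n\ (\mathrm{mod}\ 2)}}\Big(\sum_{\substack{I\in\mathcal{I},\ I\subseteq[0,n)\\ |I|=k}}\prod_{i\in I}m_i\Big)\lambda^k .$$ Define $g_n(\lambda)=f_n(\lambda,1,-1,\dots,(-1)^{n-1})$, i.e. $f_n$ evaluated at $m_i=(-1)^i$ for $0\le i\le n-1$. -}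

module Defs where

open import Data.Bool using (Bool; true; false; if_then_else_; _∧_)
open import Data.Nat using (ℕ; zero; suc; _∸_; _%_; _≡ᵇ_)
open import Data.Fin using (Fin; toℕ)
open import Data.Fin.Subset using (Subset; ∣_∣)
open import Data.Vec using (Vec; []; _∷_)
open import Data.List using (List; []; _∷_; _++_; map; foldr; upTo)
open import Algebra.Bundles using (CommutativeRing)

allSubsets : (n : ℕ) → List (Subset n)
allSubsets zero    = [] ∷ []
allSubsets (suc n) = map (true ∷_) (allSubsets n) ++ map (false ∷_) (allSubsets n)

-- admissibleFrom i c p : scanning the characteristic vector p of positions
-- i, i+1, ..., where c = number of elements of I already seen (in [0,i)),
-- checks that every element j of I satisfies j ≡ |[0,j) ∩ I| (mod 2).
admissibleFrom : ∀ {n} → ℕ → ℕ → Subset n → Bool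
admissibleFrom i c []          = true
admissibleFrom i c (true ∷ p)  = ((i % 2) ≡ᵇ (c % 2)) ∧ admissibleFrom (suc i) (suc c) p
admissibleFrom i c (false ∷ p) = admissibleFrom (suc i) c p

admissible : ∀ {n} → Subset n → Bool
admissible = admissibleFrom 0 0

module _ {c ℓ} (R : CommutativeRing c ℓ) where
  open CommutativeRing R

  pow : Carrier → ℕ → Carrier
  pow x zero    = 1#
  pow x (suc k) = x * pow x k

  sumL : List Carrier → Carrier
  sumL = foldr _+_ 0#

  prodL : List Carrier → Carrier
  prodL = foldr _*_ 1#

  prodOver : ∀ {n} → (Fin n → Carrier) → Subset n → Carrier
  prodOver {zero}  m []          = 1#
  prodOver {suc n} m (true ∷ p)  = m Fin.zero * prodOver (λ i → m (Fin.suc i)) p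
  prodOver {suc n} m (false ∷ p) = prodOver (λ i → m (Fin.suc i)) p

  f : (n : ℕ) → Carrier → (Fin n → Carrier) → Carrier
  f n x m = sumL (map term (allSubsets n))
    where
    term : Subset n → Carrier
    term I = if admissible I ∧ ((∣ I ∣ % 2) ≡ᵇ (n % 2))
               then prodOver m I * pow x ∣ I ∣
               else 0#

  g : (n : ℕ) → Carrier → Carrier
  g n x = f n x (λ i → pow (- 1#) (toℕ i))

  -- ζ^j + ζ^{-j}, written ζ^j + ζ^{m-j} using ζ^m = 1
  twoCos : (m : ℕ) → Carrier → ℕ → Carrier
  twoCos m ζ j = pow ζ j + pow ζ (m ∸ j)

  rootProduct : (n : ℕ) → Carrier → Carrier → Carrier
  rootProduct n ζ x = prodL (map (λ k → x - twoCos (suc (suc (n Data.Nat.+ n))) ζ (suc k)) (upTo n))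

  signOf : Bool → Carrier
  signOf true  = 1#
  signOf false = - 1#

module Submission where

-- Splitting on whether 0 ∈ I shows that f is a continuant in the weights:
-- f (n+2) m = m₀ λ f (n+1) (m ∘ suc) + f n (m ∘ suc ∘ suc), the second term coming from
-- sets that skip positions 0 and 1 (an admissible set cannot skip 0 and contain 1).
-- Shifting the alternating weights (−1)ⁱ negates them, and negating all weights multiplies
-- f n by (−1)ⁿ, so gₙ obeys the recurrence of the Chebyshev polynomials Uₙ(λ/2) up to a
-- sign. Substituting λ = t + t⁻¹ gives Uₙ (t − t⁻¹) = tⁿ⁺¹ − t⁻⁽ⁿ⁺¹⁾, so for a primitive
-- (2n+2)-th root of unity ζ the n values ζʲ + ζ⁻ʲ (1 ≤ j ≤ n) are distinct roots of the
-- monic degree-n polynomial Uₙ; over an integral domain Uₙ is therefore their product.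

open import Defs
open import Level using (Level; _⊔_)
open import Algebra.Bundles using (CommutativeRing)
open import Data.Bool using (Bool; true; false; not; if_then_else_; _∧_)
open import Data.Nat as ℕ using (ℕ; zero; suc; _∸_; _%_; _≡ᵇ_; _<_; _≤_; z≤n; s≤s)
import Data.Nat.Properties as ℕ
open import Data.Integer as ℤ using (ℤ; +_; -[1+_]; _⊖_; sign; _◃_)
import Data.Integer.Properties as ℤ
open import Data.Sign as Sign using (Sign)
open import Data.Fin using (Fin; toℕ)
open import Data.Fin.Subset using (Subset; ∣_∣)
open import Data.Vec using ([]; _∷_)
open import Data.Vec.Functional using (head; tail)
open import Data.List using (List; []; _∷_; _++_; map; length; applyUpTo)
import Data.List.Properties as List
open import Data.List.Relation.Unary.All as All using (All; []; _∷_)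
import Data.List.Relation.Unary.All.Properties as All
open import Data.List.Relation.Unary.AllPairs using (AllPairs; []; _∷_)
import Data.List.Relation.Unary.AllPairs.Properties as AllPairs
open import Data.Maybe using (Maybe; just; nothing)
open import Data.Product using (Σ; _×_; _,_)
open import Data.Sum as Sum using (_⊎_; [_,_]′)
open import Data.Empty using (⊥-elim)
open import Function using (_∘_; id)
open import Relation.Nullary using (¬_; yes; no)
open import Relation.Binary.PropositionalEquality as ≡ using (_≡_)
import Algebra.Solver.Ring.AlmostCommutativeRing as ACR

module IntegerCoefficients {c ℓ} (R : CommutativeRing c ℓ) where
  open CommutativeRing R
  open import Algebra.Properties.Ring ring using (-1*x≈-x; -‿involutive; -‿+-comm; -0#≈0#)
  open import Algebra.Properties.CommutativeSemigroup using (interchange)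
  open import Algebra.Properties.Semiring.Mult.TCOptimised semiring
    using (1+×; ×-homo-+; ×1-homo-*) renaming (_×_ to _×′_)
  open import Relation.Binary.Reasoning.Setoid setoid

  -- The optimised multiple _×′_ makes ι (+ 0) and ι (+ 1) reduce to 0# and 1#, so solver
  -- constants con (+ 0) and con (+ 1) match 0# and 1# in goals.
  ι : ℤ → Carrier
  ι (+ n)    = n ×′ 1#
  ι -[1+ n ] = - (suc n ×′ 1#)

  ι-⊖ : ∀ m n → ι (m ⊖ n) ≈ m ×′ 1# - n ×′ 1#
  ι-⊖ m       zero    = sym (trans (+-congˡ -0#≈0#) (+-identityʳ _))
  ι-⊖ zero    (suc n) = sym (+-identityˡ _)
  ι-⊖ (suc m) (suc n) = begin
    ι (suc m ⊖ suc n)         ≡⟨ ≡.cong ι (ℤ.[1+m]⊖[1+n]≡m⊖n m n) ⟩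
    ι (m ⊖ n)                 ≈⟨ ι-⊖ m n ⟩
    a - b                     ≈⟨ +-identityˡ _ ⟨
    0# + (a - b)              ≈⟨ +-congʳ (-‿inverseʳ 1#) ⟨
    (1# - 1#) + (a - b)       ≈⟨ interchange +-commutativeSemigroup 1# (- 1#) a (- b) ⟩
    (1# + a) + (- 1# - b)     ≈⟨ +-congˡ (-‿+-comm 1# b) ⟩
    (1# + a) - (1# + b)       ≈⟨ +-cong (1+× m 1#) (-‿cong (1+× n 1#)) ⟨
    suc m ×′ 1# - suc n ×′ 1# ∎
    where a = m ×′ 1#; b = n ×′ 1#

  ι-+ : ∀ i j → ι (i ℤ.+ j) ≈ ι i + ι j
  ι-+ -[1+ m ] -[1+ n ] = begin
    - (suc (suc (m ℕ.+ n)) ×′ 1#)   ≡⟨ ≡.cong (λ k → - (suc k ×′ 1#)) (ℕ.+-suc m n) ⟨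
    - ((suc m ℕ.+ suc n) ×′ 1#)     ≈⟨ -‿cong (×-homo-+ 1# (suc m) (suc n)) ⟩
    - (suc m ×′ 1# + suc n ×′ 1#)   ≈⟨ -‿+-comm _ _ ⟨
    - (suc m ×′ 1#) - (suc n ×′ 1#) ∎
  ι-+ -[1+ m ] (+ n)    = trans (ι-⊖ n (suc m)) (+-comm _ _)
  ι-+ (+ m)    -[1+ n ] = ι-⊖ m (suc n)
  ι-+ (+ m)    (+ n)    = ×-homo-+ 1# m n

  sg : Sign → Carrier
  sg Sign.+ = 1#
  sg Sign.- = - 1#

  sg-* : ∀ s t → sg (s Sign.* t) ≈ sg s * sg t
  sg-* Sign.+ t      = sym (*-identityˡ _)
  sg-* Sign.- Sign.+ = sym (*-identityʳ _)
  sg-* Sign.- Sign.- = sym (trans (-1*x≈-x (- 1#)) (-‿involutive 1#))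

  ι-◃ : ∀ s n → ι (s ◃ n) ≈ sg s * (n ×′ 1#)
  ι-◃ s      zero    = sym (zeroʳ _)
  ι-◃ Sign.+ (suc n) = sym (*-identityˡ _)
  ι-◃ Sign.- (suc n) = sym (-1*x≈-x _)

  ι-sign-abs : ∀ i → ι i ≈ sg (sign i) * (ℤ.∣ i ∣ ×′ 1#)
  ι-sign-abs (+ n)    = sym (*-identityˡ _)
  ι-sign-abs -[1+ n ] = sym (-1*x≈-x _)

  ι-* : ∀ i j → ι (i ℤ.* j) ≈ ι i * ι j
  ι-* i j = begin
    ι (i ℤ.* j)
      ≈⟨ ι-◃ (sign i Sign.* sign j) (∣i∣ ℕ.* ∣j∣) ⟩
    sg (sign i Sign.* sign j) * ((∣i∣ ℕ.* ∣j∣) ×′ 1#)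
      ≈⟨ *-cong (sg-* (sign i) (sign j)) (×1-homo-* ∣i∣ ∣j∣) ⟩
    (sg (sign i) * sg (sign j)) * (∣i∣ ×′ 1# * ∣j∣ ×′ 1#)
      ≈⟨ interchange *-commutativeSemigroup _ _ _ _ ⟩
    (sg (sign i) * ∣i∣ ×′ 1#) * (sg (sign j) * ∣j∣ ×′ 1#)
      ≈⟨ *-cong (ι-sign-abs i) (ι-sign-abs j) ⟨
    ι i * ι j ∎
    where ∣i∣ = ℤ.∣ i ∣; ∣j∣ = ℤ.∣ j ∣

  ι-neg : ∀ i → ι (ℤ.- i) ≈ - ι i
  ι-neg (+ zero)  = sym -0#≈0#
  ι-neg (+ suc n) = refl
  ι-neg -[1+ n ]  = sym (-‿involutive _)

  ι-homomorphism : ℤ.+-*-rawRing ACR.-Raw-AlmostCommutative⟶ ACR.fromCommutativeRing R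
  ι-homomorphism = record
    { ⟦_⟧ = ι ; +-homo = ι-+ ; *-homo = ι-* ; -‿homo = ι-neg ; 0-homo = refl ; 1-homo = refl }

  ι-≟ : ∀ i j → Maybe (ι i ≈ ι j)
  ι-≟ i j with i ℤ.≟ j
  ... | yes ≡.refl = just refl
  ... | no _       = nothing

  open import Algebra.Solver.Ring ℤ.+-*-rawRing (ACR.fromCommutativeRing R) ι-homomorphism ι-≟ public
    using (solve; _:=_; _:+_; _:*_; _:-_; :-_; con)

parity-≡ᵇ-suc : ∀ a b → (suc a % 2 ≡ᵇ suc b % 2) ≡ (a % 2 ≡ᵇ b % 2)
parity-≡ᵇ-suc (suc (suc a)) b             = parity-≡ᵇ-suc a b
parity-≡ᵇ-suc a             (suc (suc b)) = parity-≡ᵇ-suc a b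
parity-≡ᵇ-suc 0             0             = ≡.refl
parity-≡ᵇ-suc 0             1             = ≡.refl
parity-≡ᵇ-suc 1             0             = ≡.refl
parity-≡ᵇ-suc 1             1             = ≡.refl

admissibleFrom-suc : ∀ {n} i c (p : Subset n) → admissibleFrom (suc i) (suc c) p ≡ admissibleFrom i c p
admissibleFrom-suc i c []          = ≡.refl
admissibleFrom-suc i c (true ∷ p)  = ≡.cong₂ _∧_ (parity-≡ᵇ-suc i c) (admissibleFrom-suc (suc i) (suc c) p)
admissibleFrom-suc i c (false ∷ p) = admissibleFrom-suc (suc i) c p

admissibleFrom-2+ : ∀ {n} i c (p : Subset n) → admissibleFrom (2 ℕ.+ i) c p ≡ admissibleFrom i c p
admissibleFrom-2+ i c []          = ≡.refl
admissibleFrom-2+ i c (true ∷ p)  = ≡.cong ((i % 2 ≡ᵇ c % 2) ∧_) (admissibleFrom-2+ (suc i) (suc c) p)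
admissibleFrom-2+ i c (false ∷ p) = admissibleFrom-2+ (suc i) c p

module Continuant {c ℓ} (R : CommutativeRing c ℓ) where
  open CommutativeRing R
  open IntegerCoefficients R
  open import Algebra.Properties.CommutativeSemigroup *-commutativeSemigroup using (interchange)
  open import Algebra.Properties.Semiring.Exp semiring using (_^_)
  open import Relation.Binary.Reasoning.Setoid setoid

  sumL-++ : ∀ xs ys → sumL R (xs ++ ys) ≈ sumL R xs + sumL R ys
  sumL-++ []       ys = sym (+-identityˡ _)
  sumL-++ (x ∷ xs) ys = trans (+-congˡ (sumL-++ xs ys)) (sym (+-assoc _ _ _))

  sumL-map-cong : ∀ {A : Set} {s t : A → Carrier} → (∀ a → s a ≈ t a) →
                  ∀ xs → sumL R (map s xs) ≈ sumL R (map t xs)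
  sumL-map-cong e []       = refl
  sumL-map-cong e (a ∷ xs) = +-cong (e a) (sumL-map-cong e xs)

  sumL-map-scale : ∀ {A : Set} {s t : A → Carrier} (k : Carrier) → (∀ a → s a ≈ k * t a) →
                   ∀ xs → sumL R (map s xs) ≈ k * sumL R (map t xs)
  sumL-map-scale k e []       = sym (zeroʳ k)
  sumL-map-scale k e (a ∷ xs) = trans (+-cong (e a) (sumL-map-scale k e xs)) (sym (distribˡ k _ _))

  sumL-zero : ∀ {A : Set} (xs : List A) → sumL R (map (λ _ → 0#) xs) ≈ 0#
  sumL-zero []       = refl
  sumL-zero (a ∷ xs) = trans (+-identityˡ _) (sumL-zero xs)

  sumL-allSubsets-suc : ∀ n (t : Subset (suc n) → Carrier) →
    sumL R (map t (allSubsets (suc n))) ≈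
    sumL R (map (t ∘ (true ∷_)) (allSubsets n)) + sumL R (map (t ∘ (false ∷_)) (allSubsets n))
  sumL-allSubsets-suc n t = begin
    sumL R (map t (map (true ∷_) S ++ map (false ∷_) S))
      ≡⟨ ≡.cong (sumL R) (List.map-++ t (map (true ∷_) S) (map (false ∷_) S)) ⟩
    sumL R (map t (map (true ∷_) S) ++ map t (map (false ∷_) S))
      ≡⟨ ≡.cong₂ (λ xs ys → sumL R (xs ++ ys)) (List.map-∘ S) (List.map-∘ S) ⟨
    sumL R (map (t ∘ (true ∷_)) S ++ map (t ∘ (false ∷_)) S)
      ≈⟨ sumL-++ (map (t ∘ (true ∷_)) S) (map (t ∘ (false ∷_)) S) ⟩
    sumL R (map (t ∘ (true ∷_)) S) + sumL R (map (t ∘ (false ∷_)) S) ∎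
    where S = allSubsets n

  scale-if : ∀ b {u v} (a : Carrier) → u ≈ a * v → (if b then u else 0#) ≈ a * (if b then v else 0#)
  scale-if true  a e = e
  scale-if false a e = sym (zeroʳ a)

  module _ (x : Carrier) where

    monomial : ∀ {n} → (Fin n → Carrier) → Subset n → Carrier
    monomial m I = prodOver R m I * pow R x ∣ I ∣

    -- f R n x m unfolds to the sum of term n m over allSubsets n; the parity target r is
    -- kept separate from the length of m so that it can follow the recursion.
    term : ∀ {n} → ℕ → (Fin n → Carrier) → Subset n → Carrier
    term r m I = if admissible I ∧ (∣ I ∣ % 2 ≡ᵇ r % 2) then monomial m I else 0#

    term-true : ∀ {n} r (m : Fin (suc n) → Carrier) p →
                term (suc r) m (true ∷ p) ≈ (head m * x) * term r (tail m) p
    term-true r m p = begin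
      term (suc r) m (true ∷ p)
        ≡⟨ ≡.cong (λ b → if b then _ else 0#)
                  (≡.cong₂ _∧_ (admissibleFrom-suc 0 0 p) (parity-≡ᵇ-suc ∣ p ∣ r)) ⟩
      (if admissible p ∧ (∣ p ∣ % 2 ≡ᵇ r % 2) then (head m * P) * (x * X) else 0#)
        ≈⟨ scale-if _ (head m * x) (interchange (head m) P x X) ⟩
      (head m * x) * term r (tail m) p ∎
      where P = prodOver R (tail m) p; X = pow R x ∣ p ∣

    term-false-false : ∀ {n} r (m : Fin (suc (suc n)) → Carrier) p →
                       term (suc (suc r)) m (false ∷ false ∷ p) ≡ term r (tail (tail m)) p
    term-false-false r m p = ≡.cong (λ b → if b ∧ (∣ p ∣ % 2 ≡ᵇ r % 2) then monomial (tail (tail m)) p else 0#)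
                                    (admissibleFrom-2+ 0 0 p)

    f-zero : ∀ m → f R 0 x m ≈ 1#
    f-zero m = trans (+-identityʳ _) (*-identityˡ 1#)

    f-one : ∀ m → f R 1 x m ≈ head m * x
    f-one m = solve 2 (λ a y → (a :* con (+ 1)) :* (y :* con (+ 1)) :+ (con (+ 0) :+ con (+ 0)) := a :* y)
                      refl (head m) x

    -- The terms of the sets false ∷ true ∷ p reduce to 0# by computation.
    f-recurrence : ∀ n m →
      f R (suc (suc n)) x m ≈ (head m * x) * f R (suc n) x (tail m) + f R n x (tail (tail m))
    f-recurrence n m = begin
      f R (suc (suc n)) x m
        ≈⟨ sumL-allSubsets-suc (suc n) _ ⟩
      sumL R (map (λ p → term r m (true ∷ p)) S₁) + sumL R (map (λ p → term r m (false ∷ p)) S₁)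
        ≈⟨ +-cong (sumL-map-scale _ (term-true (suc n) m) S₁) (sumL-allSubsets-suc n _) ⟩
      (head m * x) * f R (suc n) x (tail m)
        + (sumL R (map (λ _ → 0#) S₀) + sumL R (map (λ p → term r m (false ∷ false ∷ p)) S₀))
        ≈⟨ +-congˡ (+-cong (sumL-zero S₀) (sumL-map-cong (reflexive ∘ term-false-false n m) S₀)) ⟩
      (head m * x) * f R (suc n) x (tail m) + (0# + f R n x (tail (tail m)))
        ≈⟨ +-congˡ (+-identityˡ _) ⟩
      (head m * x) * f R (suc n) x (tail m) + f R n x (tail (tail m)) ∎
      where r = suc (suc n); S₁ = allSubsets (suc n); S₀ = allSubsets n

    f-cong : ∀ n {m m′ : Fin n → Carrier} → (∀ i → m i ≈ m′ i) → f R n x m ≈ f R n x m′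
    f-cong zero          {m} {m′} e = trans (f-zero m) (sym (f-zero m′))
    f-cong (suc zero)    {m} {m′} e = trans (f-one m) (trans (*-congʳ (e Fin.zero)) (sym (f-one m′)))
    f-cong (suc (suc n)) {m} {m′} e = begin
      f R (suc (suc n)) x m
        ≈⟨ f-recurrence n m ⟩
      (head m * x) * f R (suc n) x (tail m) + f R n x (tail (tail m))
        ≈⟨ +-cong (*-cong (*-congʳ (e Fin.zero)) (f-cong (suc n) (e ∘ Fin.suc)))
                  (f-cong n (e ∘ Fin.suc ∘ Fin.suc)) ⟩
      (head m′ * x) * f R (suc n) x (tail m′) + f R n x (tail (tail m′))
        ≈⟨ f-recurrence n m′ ⟨
      f R (suc (suc n)) x m′ ∎

    f-neg : ∀ n (m : Fin n → Carrier) → f R n x (λ i → - m i) ≈ (- 1#) ^ n * f R n x m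
    f-neg zero          m = trans (f-zero (λ i → - m i)) (sym (trans (*-identityˡ _) (f-zero m)))
    f-neg (suc zero)    m = begin
      f R 1 x (λ i → - m i)     ≈⟨ f-one (λ i → - m i) ⟩
      - head m * x              ≈⟨ solve 2 (λ a y → :- a :* y := (:- con (+ 1) :* con (+ 1)) :* (a :* y))
                                           refl (head m) x ⟩
      (- 1#) ^ 1 * (head m * x) ≈⟨ *-congˡ (f-one m) ⟨
      (- 1#) ^ 1 * f R 1 x m    ∎
    f-neg (suc (suc n)) m = begin
      f R (suc (suc n)) x (λ i → - m i)
        ≈⟨ f-recurrence n (λ i → - m i) ⟩
      (- head m * x) * f R (suc n) x (λ i → - tail m i) + f R n x (λ i → - tail (tail m) i)
        ≈⟨ +-cong (*-congˡ (f-neg (suc n) (tail m))) (f-neg n (tail (tail m))) ⟩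
      (- head m * x) * ((- 1#) ^ suc n * A) + (- 1#) ^ n * B
        ≈⟨ solve 5 (λ a y e A B → (:- a :* y) :* ((:- con (+ 1) :* e) :* A) :+ e :* B
                                := (:- con (+ 1) :* (:- con (+ 1) :* e)) :* ((a :* y) :* A :+ B))
                   refl (head m) x ((- 1#) ^ n) A B ⟩
      (- 1#) ^ suc (suc n) * ((head m * x) * A + B)
        ≈⟨ *-congˡ (f-recurrence n m) ⟨
      (- 1#) ^ suc (suc n) * f R (suc (suc n)) x m ∎
      where A = f R (suc n) x (tail m); B = f R n x (tail (tail m))

module Powers {c ℓ} (R : CommutativeRing c ℓ) where
  open CommutativeRing R
  open IntegerCoefficients R
  open import Algebra.Properties.Semiring.Exp semiring using (_^_; ^-congˡ; ^-homo-*)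
  open import Algebra.Properties.CommutativeSemiring.Exp commutativeSemiring using (^-distrib-*)
  open import Relation.Binary.Reasoning.Setoid setoid

  pow≡^ : ∀ x n → pow R x n ≡ x ^ n
  pow≡^ x zero    = ≡.refl
  pow≡^ x (suc n) = ≡.cong (x *_) (pow≡^ x n)

  1#^n≈1# : ∀ n → 1# ^ n ≈ 1#
  1#^n≈1# zero    = refl
  1#^n≈1# (suc n) = trans (*-identityˡ _) (1#^n≈1# n)

  -- tᵃ is its own inverse, and uᵃ is also an inverse of tᵃ.
  ^-half-order : ∀ a {t u} → t * u ≈ 1# → t ^ (a ℕ.+ a) ≈ 1# → t ^ a ≈ u ^ a
  ^-half-order a {t} {u} tu≈1 t^2a≈1 = begin
    t ^ a                   ≈⟨ *-identityʳ _ ⟨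
    t ^ a * 1#              ≈⟨ *-congˡ (trans (sym (^-distrib-* t u a)) (trans (^-congˡ a tu≈1) (1#^n≈1# a))) ⟨
    t ^ a * (t ^ a * u ^ a) ≈⟨ *-assoc _ _ _ ⟨
    (t ^ a * t ^ a) * u ^ a ≈⟨ *-congʳ (trans (sym (^-homo-* t a a)) t^2a≈1) ⟩
    1# * u ^ a              ≈⟨ *-identityˡ _ ⟩
    u ^ a                   ∎

  inverse-cancel : ∀ {a b c} → a * b ≈ 1# → a * c ≈ a → c ≈ 1#
  inverse-cancel {a} {b} {c} ab≈1 ac≈a = begin
    c           ≈⟨ *-identityˡ c ⟨
    1# * c      ≈⟨ *-congʳ ab≈1 ⟨
    (a * b) * c ≈⟨ solve 3 (λ a b c → (a :* b) :* c := (a :* c) :* b) refl a b c ⟩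
    (a * c) * b ≈⟨ *-congʳ ac≈a ⟩
    a * b       ≈⟨ ab≈1 ⟩
    1#          ∎

module PolynomialFunctions {c ℓ} (R : CommutativeRing c ℓ) where
  open CommutativeRing R
  open IntegerCoefficients R
  open import Algebra.Properties.Ring ring using (x∙y⁻¹≈ε⇒x≈y)
  open import Relation.Binary.Reasoning.Setoid setoid

  NoZeroDivisors : Set (c ⊔ ℓ)
  NoZeroDivisors = ∀ x y → x * y ≈ 0# → x ≈ 0# ⊎ y ≈ 0#

  -- Polynomial n k F: F is a polynomial function of degree at most n whose coefficient of xⁿ is k.
  data Polynomial : ℕ → Carrier → (Carrier → Carrier) → Set (c ⊔ ℓ) where
    constant : ∀ {k F} → (∀ x → F x ≈ k) → Polynomial 0 k F
    horner   : ∀ {n k F} a G → Polynomial n k G → (∀ x → F x ≈ a + x * G x) → Polynomial (suc n) k F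

  polynomial-x* : ∀ {n k F} → Polynomial n k F → Polynomial (suc n) k (λ x → x * F x)
  polynomial-x* {F = F} P = horner 0# F P (λ x → sym (+-identityˡ _))

  polynomial-raise : ∀ {n k F} → Polynomial n k F → Polynomial (suc n) 0# F
  polynomial-raise {k = k} (constant e) = horner k (λ _ → 0#) (constant (λ _ → refl))
    (λ x → trans (e x) (solve 2 (λ k x → k := k :+ x :* con (+ 0)) refl k x))
  polynomial-raise (horner a G P e) = horner a G (polynomial-raise P) e

  polynomial-−-lower : ∀ {n k k′ F G} → Polynomial (suc n) k F → Polynomial n k′ G →
                       Polynomial (suc n) k (λ x → F x - G x)
  polynomial-−-lower {k′ = k′} (horner a F′ P e) (constant e′) = horner (a - k′) F′ P
    (λ x → trans (+-cong (e x) (-‿cong (e′ x)))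
                 (solve 4 (λ a x y k → (a :+ x :* y) :- k := (a :- k) :+ x :* y) refl a x (F′ x) k′))
  polynomial-−-lower (horner a F′ P e) (horner b G′ Q e′) =
    horner (a - b) (λ x → F′ x - G′ x) (polynomial-−-lower P Q)
    (λ x → trans (+-cong (e x) (-‿cong (e′ x)))
                 (solve 5 (λ a b x y z → (a :+ x :* y) :- (b :+ x :* z) := (a :- b) :+ x :* (y :- z))
                          refl a b x (F′ x) (G′ x)))

  divide-by-linear : ∀ {n k F} → Polynomial (suc n) k F → ∀ r →
                     Σ (Carrier → Carrier) λ Q → Polynomial n k Q × (∀ x → F x ≈ (x - r) * Q x + F r)
  divide-by-linear {zero} {F = F} (horner a G (constant e′) e) r =
    (λ _ → G r) , constant (λ _ → e′ r) , λ x → begin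
    F x                           ≈⟨ e x ⟩
    a + x * G x                   ≈⟨ +-congˡ (*-congˡ (trans (e′ x) (sym (e′ r)))) ⟩
    a + x * G r                   ≈⟨ solve 4 (λ a x r g → a :+ x :* g := (x :- r) :* g :+ (a :+ r :* g))
                                             refl a x r (G r) ⟩
    (x - r) * G r + (a + r * G r) ≈⟨ +-congˡ (e r) ⟨
    (x - r) * G r + F r           ∎
  divide-by-linear {suc n} {F = F} (horner a G P e) r with divide-by-linear P r
  ... | Q , PQ , eQ = (λ x → G r + x * Q x) , horner (G r) Q PQ (λ _ → refl) , λ x → begin
    F x                                       ≈⟨ e x ⟩
    a + x * G x                               ≈⟨ +-congˡ (*-congˡ (eQ x)) ⟩
    a + x * ((x - r) * Q x + G r)             ≈⟨ solve 5 (λ a x r q g → a :+ x :* ((x :- r) :* q :+ g)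
                                                                   := (x :- r) :* (g :+ x :* q) :+ (a :+ r :* g))
                                                         refl a x r (Q x) (G r) ⟩
    (x - r) * (G r + x * Q x) + (a + r * G r) ≈⟨ +-congˡ (e r) ⟨
    (x - r) * (G r + x * Q x) + F r           ∎

  factorise-by-roots : NoZeroDivisors → ∀ {I : Set} {k F} (h : I → Carrier) (is : List I) →
    AllPairs (λ i j → ¬ h i ≈ h j) is → All (λ i → F (h i) ≈ 0#) is → Polynomial (length is) k F →
    ∀ x → F x ≈ k * prodL R (map (λ i → x - h i) is)
  factorise-by-roots _   h []       _ _ (constant e) x = trans (e x) (sym (*-identityʳ _))
  factorise-by-roots nzd {k = k} {F} h (i ∷ is) (hi≉ ∷ distinct) (Fhi≈0 ∷ roots) P x
    with divide-by-linear P (h i)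
  ... | Q , PQ , eQ = begin
    F x
      ≈⟨ F≈[x-hi]Q x ⟩
    (x - h i) * Q x
      ≈⟨ *-congˡ (factorise-by-roots nzd h is distinct Q-roots PQ x) ⟩
    (x - h i) * (k * prodL R (map (λ j → x - h j) is))
      ≈⟨ solve 3 (λ a k p → a :* (k :* p) := k :* (a :* p)) refl _ k _ ⟩
    k * prodL R (map (λ j → x - h j) (i ∷ is)) ∎
    where
    F≈[x-hi]Q : ∀ y → F y ≈ (y - h i) * Q y
    F≈[x-hi]Q y = trans (eQ y) (trans (+-congˡ Fhi≈0) (+-identityʳ _))

    Q-root : ∀ {j} → ¬ h i ≈ h j → F (h j) ≈ 0# → Q (h j) ≈ 0#
    Q-root {j} hi≉hj Fhj≈0 =
      [ ⊥-elim ∘ hi≉hj ∘ sym ∘ x∙y⁻¹≈ε⇒x≈y (h j) (h i) , id ]′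
        (nzd (h j - h i) (Q (h j)) (trans (sym (F≈[x-hi]Q (h j))) Fhj≈0))

    Q-roots : All (λ j → Q (h j) ≈ 0#) is
    Q-roots = All.zipWith (λ (hi≉hj , Fhj≈0) → Q-root hi≉hj Fhj≈0) (hi≉ , roots)

module ChebyshevU {c ℓ} (R : CommutativeRing c ℓ) where
  open CommutativeRing R
  open IntegerCoefficients R
  open PolynomialFunctions R
  open Powers R
  open import Algebra.Properties.Ring ring using (x∙y⁻¹≈ε⇒x≈y; x≈y⇒x∙y⁻¹≈ε)
  open import Algebra.Properties.Semiring.Exp semiring using (_^_)
  open import Relation.Binary.Reasoning.Setoid setoid

  -- chebyshevU n x = Uₙ(x/2), so that chebyshevU n (2 cos θ) = sin((n+1)θ) / sin θ.
  chebyshevU : ℕ → Carrier → Carrier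
  chebyshevU zero          x = 1#
  chebyshevU (suc zero)    x = x
  chebyshevU (suc (suc n)) x = x * chebyshevU (suc n) x - chebyshevU n x

  polynomial-chebyshevU : ∀ n → Polynomial n 1# (chebyshevU n)
  polynomial-chebyshevU zero          = constant (λ _ → refl)
  polynomial-chebyshevU (suc zero)    = horner 0# (λ _ → 1#) (constant (λ _ → refl))
    (λ x → solve 1 (λ x → x := con (+ 0) :+ x :* con (+ 1)) refl x)
  polynomial-chebyshevU (suc (suc n)) =
    polynomial-−-lower (polynomial-x* (polynomial-chebyshevU (suc n))) (polynomial-raise (polynomial-chebyshevU n))

  chebyshevU-reciprocal : ∀ n {t u} → t * u ≈ 1# → chebyshevU n (t + u) * (t - u) ≈ t ^ suc n - u ^ suc n
  chebyshevU-reciprocal zero          {t} {u} _ =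
    solve 2 (λ t u → con (+ 1) :* (t :- u) := t :* con (+ 1) :- u :* con (+ 1)) refl t u
  chebyshevU-reciprocal (suc zero)    {t} {u} _ =
    solve 2 (λ t u → (t :+ u) :* (t :- u) := t :* (t :* con (+ 1)) :- u :* (u :* con (+ 1))) refl t u
  chebyshevU-reciprocal (suc (suc n)) {t} {u} tu≈1 = begin
    ((t + u) * U₁ - U₀) * (t - u)
      ≈⟨ solve 4 (λ t u a b → ((t :+ u) :* a :- b) :* (t :- u) := (t :+ u) :* (a :* (t :- u)) :- b :* (t :- u))
                 refl t u U₁ U₀ ⟩
    (t + u) * (U₁ * (t - u)) - U₀ * (t - u)
      ≈⟨ +-cong (*-congˡ (chebyshevU-reciprocal (suc n) tu≈1)) (-‿cong (chebyshevU-reciprocal n tu≈1)) ⟩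
    (t + u) * (t * T - u * V) - (T - V)
      ≈⟨ solve 4 (λ t u T V → (t :+ u) :* (t :* T :- u :* V) :- (T :- V)
                            := t :* (t :* T) :- u :* (u :* V) :+ (t :* u :- con (+ 1)) :* (T :- V))
                 refl t u T V ⟩
    t * (t * T) - u * (u * V) + (t * u - 1#) * (T - V)
      ≈⟨ +-congˡ (*-congʳ (x≈y⇒x∙y⁻¹≈ε tu≈1)) ⟩
    t * (t * T) - u * (u * V) + 0# * (T - V)
      ≈⟨ trans (+-congˡ (zeroˡ _)) (+-identityʳ _) ⟩
    t * (t * T) - u * (u * V) ∎
    where
    U₁ = chebyshevU (suc n) (t + u)
    U₀ = chebyshevU n (t + u)
    T = t ^ suc n
    V = u ^ suc n

  chebyshevU-root : NoZeroDivisors → ∀ n {t u} → t * u ≈ 1# → t ^ (suc n ℕ.+ suc n) ≈ 1# → ¬ t ≈ u →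
                    chebyshevU n (t + u) ≈ 0#
  chebyshevU-root nzd n {t} {u} tu≈1 t^[2n+2]≈1 t≉u =
    [ id , ⊥-elim ∘ t≉u ∘ x∙y⁻¹≈ε⇒x≈y t u ]′ (nzd (chebyshevU n (t + u)) (t - u) product≈0)
    where
    product≈0 : chebyshevU n (t + u) * (t - u) ≈ 0#
    product≈0 = trans (chebyshevU-reciprocal n tu≈1) (x≈y⇒x∙y⁻¹≈ε (^-half-order (suc n) tu≈1 t^[2n+2]≈1))

  reciprocal-sum-injective : NoZeroDivisors → ∀ {t u t′ u′} → t * u ≈ 1# → t′ * u′ ≈ 1# →
                             t + u ≈ t′ + u′ → t ≈ t′ ⊎ t * t′ ≈ 1#
  reciprocal-sum-injective nzd {t} {u} {t′} {u′} tu≈1 t′u′≈1 sums≈ =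
    Sum.map (x∙y⁻¹≈ε⇒x≈y t t′) tt′≈1 (nzd (t - t′) (1# - u * u′) product≈0)
    where
    product≈0 : (t - t′) * (1# - u * u′) ≈ 0#
    product≈0 = begin
      (t - t′) * (1# - u * u′)
        ≈⟨ solve 4 (λ t t′ u u′ → (t :- t′) :* (con (+ 1) :- u :* u′)
                              := (t :+ u) :- (t′ :+ u′)
                                   :- u′ :* (t :* u :- con (+ 1)) :+ u :* (t′ :* u′ :- con (+ 1)))
                   refl t t′ u u′ ⟩
      (t + u) - (t′ + u′) - u′ * (t * u - 1#) + u * (t′ * u′ - 1#)
        ≈⟨ +-cong (+-cong (x≈y⇒x∙y⁻¹≈ε sums≈) (-‿cong (*-congˡ (x≈y⇒x∙y⁻¹≈ε tu≈1))))
                  (*-congˡ (x≈y⇒x∙y⁻¹≈ε t′u′≈1)) ⟩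
      0# - u′ * 0# + u * 0#
        ≈⟨ solve 2 (λ u u′ → con (+ 0) :- u′ :* con (+ 0) :+ u :* con (+ 0) := con (+ 0)) refl u u′ ⟩
      0# ∎

    tt′≈1 : 1# - u * u′ ≈ 0# → t * t′ ≈ 1#
    tt′≈1 1-uu′≈0 = begin
      t * t′              ≈⟨ *-identityʳ _ ⟨
      (t * t′) * 1#       ≈⟨ *-congˡ (x∙y⁻¹≈ε⇒x≈y 1# (u * u′) 1-uu′≈0) ⟩
      (t * t′) * (u * u′) ≈⟨ solve 4 (λ t t′ u u′ → (t :* t′) :* (u :* u′) := (t :* u) :* (t′ :* u′))
                                     refl t t′ u u′ ⟩
      (t * u) * (t′ * u′) ≈⟨ *-cong tu≈1 t′u′≈1 ⟩
      1# * 1#             ≈⟨ *-identityʳ 1# ⟩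
      1#                  ∎

-- + + − − + + − − …, i.e. (−1)^(n(n−1)/2).
gSign : ℕ → Bool
gSign zero          = true
gSign (suc zero)    = true
gSign (suc (suc n)) = not (gSign n)

module AlternatingContinuant {c ℓ} (R : CommutativeRing c ℓ) where
  open CommutativeRing R
  open IntegerCoefficients R
  open Continuant R
  open ChebyshevU R
  open import Algebra.Properties.Ring ring using (-1*x≈-x; -‿involutive)
  open import Algebra.Properties.Semiring.Exp semiring using (_^_)
  open import Relation.Binary.Reasoning.Setoid setoid

  alternating : ∀ {n} → Fin n → Carrier
  alternating i = pow R (- 1#) (toℕ i)

  signOf-not : ∀ b → signOf R (not b) ≈ - signOf R b
  signOf-not true  = refl
  signOf-not false = sym (-‿involutive 1#)

  gSign-step : ∀ n → (- 1#) ^ suc n * signOf R (gSign (suc n)) ≈ - signOf R (gSign n)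
  gSign-step zero          = trans (*-identityʳ _) (*-identityʳ _)
  gSign-step (suc zero)    =
    solve 0 ((:- con (+ 1) :* (:- con (+ 1) :* con (+ 1))) :* (:- con (+ 1)) := :- con (+ 1)) refl
  gSign-step (suc (suc n)) = begin
    (- 1#) ^ suc (suc (suc n)) * signOf R (not (gSign (suc n)))
      ≈⟨ *-congˡ (signOf-not (gSign (suc n))) ⟩
    (- 1#) ^ suc (suc (suc n)) * - s₁
      ≈⟨ solve 2 (λ e s → (:- con (+ 1) :* (:- con (+ 1) :* e)) :* (:- s) := :- (e :* s))
                 refl ((- 1#) ^ suc n) s₁ ⟩
    - ((- 1#) ^ suc n * s₁)
      ≈⟨ -‿cong (gSign-step n) ⟩
    - - signOf R (gSign n)
      ≈⟨ -‿cong (signOf-not (gSign n)) ⟨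
    - signOf R (not (gSign n)) ∎
    where s₁ = signOf R (gSign (suc n))

  module _ (x : Carrier) where

    -- tail alternating i is definitionally -1# * alternating i.
    g-recurrence : ∀ n → g R (suc (suc n)) x ≈ x * ((- 1#) ^ suc n * g R (suc n) x) + g R n x
    g-recurrence n = begin
      g R (suc (suc n)) x
        ≈⟨ f-recurrence x n alternating ⟩
      (1# * x) * f R (suc n) x (tail alternating) + f R n x (tail (tail alternating))
        ≈⟨ +-cong (*-cong (*-identityˡ x) (trans (f-cong x (suc n) (-1*x≈-x ∘ alternating))
                                                 (f-neg x (suc n) alternating)))
                  (f-cong x n (λ i → trans (-1*x≈-x _) (trans (-‿cong (-1*x≈-x _)) (-‿involutive _)))) ⟩
      x * ((- 1#) ^ suc n * g R (suc n) x) + g R n x ∎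

    g≈±chebyshevU : ∀ n → g R n x ≈ signOf R (gSign n) * chebyshevU n x
    g≈±chebyshevU zero          = trans (f-zero x alternating) (sym (*-identityˡ 1#))
    g≈±chebyshevU (suc zero)    = f-one x alternating
    g≈±chebyshevU (suc (suc n)) = begin
      g R (suc (suc n)) x
        ≈⟨ g-recurrence n ⟩
      x * ((- 1#) ^ suc n * g R (suc n) x) + g R n x
        ≈⟨ +-cong (*-congˡ (*-congˡ (g≈±chebyshevU (suc n)))) (g≈±chebyshevU n) ⟩
      x * ((- 1#) ^ suc n * (s₁ * U₁)) + s₀ * U₀
        ≈⟨ +-congʳ (*-congˡ (trans (sym (*-assoc _ _ _)) (*-congʳ (gSign-step n)))) ⟩
      x * (- s₀ * U₁) + s₀ * U₀
        ≈⟨ solve 4 (λ x s a b → x :* (:- s :* a) :+ s :* b := :- s :* (x :* a :- b)) refl x s₀ U₁ U₀ ⟩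
      - s₀ * (x * U₁ - U₀)
        ≈⟨ *-congʳ (signOf-not (gSign n)) ⟨
      signOf R (gSign (suc (suc n))) * chebyshevU (suc (suc n)) x ∎
      where
      s₀ = signOf R (gSign n)
      s₁ = signOf R (gSign (suc n))
      U₀ = chebyshevU n x
      U₁ = chebyshevU (suc n) x

module RootsOfUnity {c ℓ} (R : CommutativeRing c ℓ) where
  open CommutativeRing R
  open PolynomialFunctions R
  open Powers R
  open ChebyshevU R
  open import Algebra.Properties.Semiring.Exp semiring using (_^_; ^-congˡ; ^-homo-*; ^-assocʳ)
  open import Relation.Binary.Reasoning.Setoid setoid

  module _ (nzd : NoZeroDivisors) (n : ℕ) (ζ : Carrier) (pow-ζ-M≈1 : pow R ζ (suc (suc (n ℕ.+ n))) ≈ 1#)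
           (pow-ζ-order : ∀ k → 0 < k → k < suc (suc (n ℕ.+ n)) → ¬ pow R ζ k ≈ 1#) where

    M : ℕ
    M = suc (suc (n ℕ.+ n))

    ζ^M≈1 : ζ ^ M ≈ 1#
    ζ^M≈1 = trans (reflexive (≡.sym (pow≡^ ζ M))) pow-ζ-M≈1

    ζ^k≉1 : ∀ {k} → 0 < k → k < M → ¬ ζ ^ k ≈ 1#
    ζ^k≉1 {k} 0<k k<M = pow-ζ-order k 0<k k<M ∘ trans (reflexive (pow≡^ ζ k))

    twoCos≡ : ∀ j → twoCos R M ζ j ≡ ζ ^ j + ζ ^ (M ∸ j)
    twoCos≡ j = ≡.cong₂ _+_ (pow≡^ ζ j) (pow≡^ ζ (M ∸ j))

    ζ^j-inverse : ∀ {j} → j ≤ M → ζ ^ j * ζ ^ (M ∸ j) ≈ 1#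
    ζ^j-inverse {j} j≤M = begin
      ζ ^ j * ζ ^ (M ∸ j) ≈⟨ ^-homo-* ζ j (M ∸ j) ⟨
      ζ ^ (j ℕ.+ (M ∸ j)) ≡⟨ ≡.cong (ζ ^_) (ℕ.m+[n∸m]≡n j≤M) ⟩
      ζ ^ M               ≈⟨ ζ^M≈1 ⟩
      1#                  ∎

    [ζ^j]^M≈1 : ∀ j → (ζ ^ j) ^ M ≈ 1#
    [ζ^j]^M≈1 j = begin
      (ζ ^ j) ^ M   ≈⟨ ^-assocʳ ζ j M ⟩
      ζ ^ (j ℕ.* M) ≡⟨ ≡.cong (ζ ^_) (ℕ.*-comm j M) ⟩
      ζ ^ (M ℕ.* j) ≈⟨ ^-assocʳ ζ M j ⟨
      (ζ ^ M) ^ j   ≈⟨ ^-congˡ j ζ^M≈1 ⟩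
      1# ^ j        ≈⟨ 1#^n≈1# j ⟩
      1#            ∎

    twoCos-injective : ∀ {i j} → 0 < i → i < j → i ℕ.+ j < M → ¬ twoCos R M ζ i ≈ twoCos R M ζ j
    twoCos-injective {i} {j} 0<i i<j i+j<M twoCos≈ =
      [ ζ^i≉ζ^j , ζ^iζ^j≉1 ]′ (reciprocal-sum-injective nzd (ζ^j-inverse i≤M) (ζ^j-inverse j≤M) sums≈)
      where
      i≤M : i ≤ M
      i≤M = ℕ.<⇒≤ (ℕ.≤-<-trans (ℕ.m≤m+n i j) i+j<M)
      j≤M : j ≤ M
      j≤M = ℕ.<⇒≤ (ℕ.≤-<-trans (ℕ.m≤n+m j i) i+j<M)
      sums≈ : ζ ^ i + ζ ^ (M ∸ i) ≈ ζ ^ j + ζ ^ (M ∸ j)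
      sums≈ = trans (reflexive (≡.sym (twoCos≡ i))) (trans twoCos≈ (reflexive (twoCos≡ j)))
      ζ^i≉ζ^j : ¬ ζ ^ i ≈ ζ ^ j
      ζ^i≉ζ^j ζ^i≈ζ^j =
        ζ^k≉1 (ℕ.m<n⇒0<n∸m i<j) (ℕ.≤-<-trans (ℕ.m∸n≤m j i) (ℕ.≤-<-trans (ℕ.m≤n+m j i) i+j<M))
        (inverse-cancel (ζ^j-inverse i≤M) (begin
          ζ ^ i * ζ ^ (j ∸ i) ≈⟨ ^-homo-* ζ i (j ∸ i) ⟨
          ζ ^ (i ℕ.+ (j ∸ i)) ≡⟨ ≡.cong (ζ ^_) (ℕ.m+[n∸m]≡n (ℕ.<⇒≤ i<j)) ⟩
          ζ ^ j               ≈⟨ ζ^i≈ζ^j ⟨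
          ζ ^ i               ∎))
      ζ^iζ^j≉1 : ¬ ζ ^ i * ζ ^ j ≈ 1#
      ζ^iζ^j≉1 = ζ^k≉1 (ℕ.<-≤-trans 0<i (ℕ.m≤m+n i j)) i+j<M ∘ trans (^-homo-* ζ i j)

    chebyshevU-twoCos-root : ∀ {j} → 0 < j → j ≤ n → chebyshevU n (twoCos R M ζ j) ≈ 0#
    chebyshevU-twoCos-root {j} 0<j j≤n = begin
      chebyshevU n (twoCos R M ζ j)
        ≡⟨ ≡.cong (chebyshevU n) (twoCos≡ j) ⟩
      chebyshevU n (ζ ^ j + ζ ^ (M ∸ j))
        ≈⟨ chebyshevU-root nzd n (ζ^j-inverse j≤M) [ζ^j]^[2n+2]≈1 ζ^j≉ζ^[M∸j] ⟩
      0# ∎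
      where
      j+j<M : j ℕ.+ j < M
      j+j<M = s≤s (ℕ.m≤n⇒m≤1+n (ℕ.+-mono-≤ j≤n j≤n))
      j≤M : j ≤ M
      j≤M = ℕ.<⇒≤ (ℕ.≤-<-trans (ℕ.m≤m+n j j) j+j<M)
      [ζ^j]^[2n+2]≈1 : (ζ ^ j) ^ (suc n ℕ.+ suc n) ≈ 1#
      [ζ^j]^[2n+2]≈1 = trans (reflexive (≡.cong ((ζ ^ j) ^_) (ℕ.+-suc (suc n) n))) ([ζ^j]^M≈1 j)
      ζ^j≉ζ^[M∸j] : ¬ ζ ^ j ≈ ζ ^ (M ∸ j)
      ζ^j≉ζ^[M∸j] ζ^j≈ζ^[M∸j] = ζ^k≉1 (ℕ.<-≤-trans 0<j (ℕ.m≤m+n j j)) j+j<M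
        (trans (^-homo-* ζ j j) (trans (*-congˡ ζ^j≈ζ^[M∸j]) (ζ^j-inverse j≤M)))

    chebyshevU≈rootProduct : ∀ x → chebyshevU n x ≈ rootProduct R n ζ x
    chebyshevU≈rootProduct x = trans (factorise-by-roots nzd root (applyUpTo id n) distinct roots polynomial x)
                                     (*-identityˡ _)
      where
      root : ℕ → Carrier
      root k = twoCos R M ζ (suc k)
      distinct : AllPairs (λ i j → ¬ root i ≈ root j) (applyUpTo id n)
      distinct = AllPairs.applyUpTo⁺₁ id n (λ i<j j<n →
        twoCos-injective (s≤s z≤n) (s≤s i<j) (s≤s (s≤s (ℕ.+-mono-≤ (ℕ.<⇒≤ (ℕ.<-trans i<j j<n)) j<n))))
      roots : All (λ k → chebyshevU n (root k) ≈ 0#) (applyUpTo id n)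
      roots = All.applyUpTo⁺₁ id n (chebyshevU-twoCos-root (s≤s z≤n))
      polynomial : Polynomial (length (applyUpTo id n)) 1# (chebyshevU n)
      polynomial = ≡.subst (λ d → Polynomial d 1# (chebyshevU n)) (≡.sym (List.length-applyUpTo id n))
                           (polynomial-chebyshevU n)

-- Opened only here: in the modules above, _+_ is the ring addition.
open import Data.Nat using (_+_)

mainTheorem5 : ∀ {c ℓ : Level} (n : ℕ) → Σ Bool λ s →
    (R : CommutativeRing c ℓ) →
        -- R is an integral domain (no zero divisors; nontriviality follows from primitivity)
    (∀ x y → CommutativeRing._≈_ R (CommutativeRing._*_ R x y) (CommutativeRing.0# R) → CommutativeRing._≈_ R x (CommutativeRing.0# R) ⊎ CommutativeRing._≈_ R y (CommutativeRing.0# R)) →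
    (ζ : CommutativeRing.Carrier R) →
    -- ζ is a primitive (2n+2)-th root of unity (e.g. e(1/(2n+2)) in ℂ)
    CommutativeRing._≈_ R (pow R ζ (suc (suc (n + n)))) (CommutativeRing.1# R) →
    (∀ k → 0 < k → k < suc (suc (n + n)) → ¬ CommutativeRing._≈_ R (pow R ζ k) (CommutativeRing.1# R)) →
    (x : CommutativeRing.Carrier R) →
    CommutativeRing._≈_ R (g R n x) (CommutativeRing._*_ R (signOf R s) (rootProduct R n ζ x))
mainTheorem5 n = gSign n , λ R nzd ζ ζ^M≈1 ζ-order x →
  CommutativeRing.trans R (AlternatingContinuant.g≈±chebyshevU R x n)
    (CommutativeRing.*-congˡ R (RootsOfUnity.chebyshevU≈rootProduct R nzd n ζ ζ^M≈1 ζ-order x))
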